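{- $\mathrm{L}\text{ - }\mathrm{ESO}_{\mathbb R}[+,\times,\le,0,1]\equiv\mathrm{ESO}_{\mathbb R}[+,\times,\le]$ and $\mathrm{L}\text{ - }\mathrm{ESO}_{\mathbb R}[+,\times,\le,(r)_{r\in\mathbb R}]\equiv\mathrm{ESO}_{\mathbb R}[+,\times,\le,(r)_{r\in\mathbb R}]$. Here $\mathcal L\equiv\mathcal L'$ means that for all finite relational $\tau$ and finite functional $\sigma$, every sentence of either logic of vocabulary $\tau\cup\sigma$ defines the same class of $\mathbb R$-structures as some sentence of the other.
   Context: Structures: for finite relational $\tau$ and finite functional $\sigma$, an $\mathbb R$-structure is $\mathfrak A=(A,\mathbb{R},(R^{\mathfrak A})_{R\in\tau},(g^{\mathfrak A})_{g\in\sigma})$ with $A$ finite nonempty, $R^{\mathfrak A}\subseteq A^{\mathrm{ar}(R)}$, $g^{\mathfrak A}:A^{\mathrm{ar}(g)}\to\mathbb R$. Logic. For $C\subseteq\mathbb R$ and $S\subseteq\mathbb R$, $\mathrm{ESO}_S[+,\times,\le,C]$ has numerical terms $i::=c\mid f(\vec x)\mid i\times i\mid i+i$ ($c\in C$, $f$ a function symbol or function variable) and formulae $\phi::=x=y\mid\neg x=y\mid i\le j\mid\neg\,i\le j\mid R(\vec x)\mid\neg R(\vec x)\mid\phi\wedge\phi\mid\phi\vee\phi\mid\exists x\phi\mid\forall x\phi\mid\exists f\phi$; first-order variables range over $A$, terms use real arithmetic, $\exists f\phi$ quantifies over functions $A^{\mathrm{ar}(f)}\to S$. $\mathrm{ESO}_{\mathbb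 R}[+,\times,\le]$ has $C=\emptyset$; $[+,\times,\le,0,1]$ has $C=\{0,1\}$; $(r)_{r\in\mathbb R}$ means $C=\mathbb R$. The loose fragment $\mathrm{L}\text{ - }\mathrm{ESO}_S[\dots]$ forbids negated numerical atoms $\neg\,i\le j$. -}

module Defs where

open import Data.Nat using (ℕ; suc)
open import Data.Fin using (Fin)
import Data.Fin as Fin
open import Data.Bool using (Bool; true; false; if_then_else_)
open import Data.Empty using (⊥)
open import Data.Unit using (⊤)
open import Data.List using (List; []; _∷_)
open import Data.List.Membership.Propositional using (_∈_)
open import Data.List.Relation.Unary.All as All using (All)
open import Data.Product using (Σ; ∃; _×_; _,_; Σ-syntax)
open import Data.Sum using (_⊎_)
open import Relation.Nullary using (¬_)
open import Relation.Binary.PropositionalEquality using (_≡_)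
open import Function using (_∘_)

-- The real numbers, axiomatised as a (Dedekind-)complete ordered field.
-- (agda-stdlib has no reals; every model of this record is ℝ up to
-- unique isomorphism.)

record RealField : Set₁ where
  infixl 6 _+_
  infixl 7 _*_
  infix 4 _≤_
  field
    ℝ    : Set
    _+_  : ℝ → ℝ → ℝ
    _*_  : ℝ → ℝ → ℝ
    -_   : ℝ → ℝ
    0r   : ℝ
    1r   : ℝ
    _≤_  : ℝ → ℝ → Set
    +-assoc     : ∀ x y z → (x + y) + z ≡ x + (y + z)
    +-comm      : ∀ x y → x + y ≡ y + x
    +-identityˡ : ∀ x → 0r + x ≡ x
    -‿inverseˡ  : ∀ x → (- x) + x ≡ 0r
    *-assoc     : ∀ x y z → (x * y) * z ≡ x * (y * z)
    *-comm      : ∀ x y → x * y ≡ y * x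
    *-identityˡ : ∀ x → 1r * x ≡ x
    distribˡ    : ∀ x y z → x * (y + z) ≡ x * y + x * z
    0≢1         : ¬ (0r ≡ 1r)
    *-inverse   : ∀ x → ¬ (x ≡ 0r) → ∃ λ y → x * y ≡ 1r
    ≤-refl      : ∀ x → x ≤ x
    ≤-trans     : ∀ {x y z} → x ≤ y → y ≤ z → x ≤ z
    ≤-antisym   : ∀ {x y} → x ≤ y → y ≤ x → x ≡ y
    ≤-total     : ∀ x y → (x ≤ y) ⊎ (y ≤ x)
    +-mono-≤    : ∀ {x y} z → x ≤ y → x + z ≤ y + z
    *-nonneg    : ∀ {x y} → 0r ≤ x → 0r ≤ y → 0r ≤ x * y
    sup : (P : ℝ → Set) → (∃ P) → (∃ λ b → ∀ x → P x → x ≤ b) →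
          ∃ λ s → (∀ x → P x → x ≤ s) × (∀ b → (∀ x → P x → x ≤ b) → s ≤ b)

record Vocab : Set where
  field
    nRel  : ℕ
    arRel : Fin nRel → ℕ
    nFun  : ℕ
    arFun : Fin nFun → ℕ
open Vocab public

module _ (R : RealField) where
  open RealField R

  -- ℝ-structures. The finite nonempty domain is Fin (suc size).
  record Structure (V : Vocab) : Set₁ where
    field
      size : ℕ
      relᴬ : (r : Fin (nRel V)) → (Fin (arRel V r) → Fin (suc size)) → Set
      funᴬ : (g : Fin (nFun V)) → (Fin (arFun V g) → Fin (suc size)) → ℝ
    Dom : Set
    Dom = Fin (suc size)
  open Structure public

  record Logic : Set₁ where
    field
      Const  : Set
      ⟦_⟧ᶜ   : Const → ℝ
      loose  : Bool   -- true: negated numerical atoms forbidden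
  open Logic public

  noConsts : Set
  noConsts = ⊥
  zeroOne : Bool → ℝ
  zeroOne b = if b then 1r else 0r

  ESO : Logic
  ESO = record { Const = ⊥ ; ⟦_⟧ᶜ = λ () ; loose = false }

  L-ESO01 : Logic
  L-ESO01 = record { Const = Bool ; ⟦_⟧ᶜ = zeroOne ; loose = true }

  ESO-ℝ : Logic
  ESO-ℝ = record { Const = ℝ ; ⟦_⟧ᶜ = λ r → r ; loose = false }

  L-ESO-ℝ : Logic
  L-ESO-ℝ = record { Const = ℝ ; ⟦_⟧ᶜ = λ r → r ; loose = true }

  -- Syntax. k = number of first-order variables in scope (de Bruijn),
  -- Γ = arities of the function variables in scope.

  module Syntax (V : Vocab) (C : Set) where

    data Term (k : ℕ) (Γ : List ℕ) : Set where
      const : C → Term k Γ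
      fsym  : (g : Fin (nFun V)) → (Fin (arFun V g) → Fin k) → Term k Γ
      fvar  : {a : ℕ} → a ∈ Γ → (Fin a → Fin k) → Term k Γ
      _⊕_   : Term k Γ → Term k Γ → Term k Γ
      _⊗_   : Term k Γ → Term k Γ → Term k Γ

    data Formula : ℕ → List ℕ → Set where
      eq   : ∀ {k Γ} → Fin k → Fin k → Formula k Γ
      neq  : ∀ {k Γ} → Fin k → Fin k → Formula k Γ
      le   : ∀ {k Γ} → Term k Γ → Term k Γ → Formula k Γ
      nle  : ∀ {k Γ} → Term k Γ → Term k Γ → Formula k Γ
      rel  : ∀ {k Γ} (r : Fin (nRel V)) → (Fin (arRel V r) → Fin k) → Formula k Γ
      nrel : ∀ {k Γ} (r : Fin (nRel V)) → (Fin (arRel V r) → Fin k) → Formula k Γ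
      and  : ∀ {k Γ} → Formula k Γ → Formula k Γ → Formula k Γ
      or   : ∀ {k Γ} → Formula k Γ → Formula k Γ → Formula k Γ
      ex   : ∀ {k Γ} → Formula (suc k) Γ → Formula k Γ
      all  : ∀ {k Γ} → Formula (suc k) Γ → Formula k Γ
      exf  : ∀ {k Γ} (a : ℕ) → Formula k (a ∷ Γ) → Formula k Γ

    data IsLoose : ∀ {k Γ} → Formula k Γ → Set where
      eq   : ∀ {k Γ} x y → IsLoose {k} {Γ} (eq x y)
      neq  : ∀ {k Γ} x y → IsLoose {k} {Γ} (neq x y)
      le   : ∀ {k Γ} i j → IsLoose {k} {Γ} (le i j)
      rel  : ∀ {k Γ} r xs → IsLoose {k} {Γ} (rel r xs)
      nrel : ∀ {k Γ} r xs → IsLoose {k} {Γ} (nrel r xs)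
      and  : ∀ {k Γ} {φ ψ : Formula k Γ} → IsLoose φ → IsLoose ψ → IsLoose (and φ ψ)
      or   : ∀ {k Γ} {φ ψ : Formula k Γ} → IsLoose φ → IsLoose ψ → IsLoose (or φ ψ)
      ex   : ∀ {k Γ} {φ : Formula (suc k) Γ} → IsLoose φ → IsLoose (ex φ)
      all  : ∀ {k Γ} {φ : Formula (suc k) Γ} → IsLoose φ → IsLoose (all φ)
      exf  : ∀ {k Γ} a {φ : Formula k (a ∷ Γ)} → IsLoose φ → IsLoose (exf a φ)

    module Sem (⟦_⟧ᶜ : C → ℝ) (𝔄 : Structure V) where

      FEnv : List ℕ → Set
      FEnv Γ = All (λ a → (Fin a → Dom 𝔄) → ℝ) Γ

      evalT : ∀ {k Γ} → (Fin k → Dom 𝔄) → FEnv Γ → Term k Γ → ℝ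
      evalT ρ η (const c)  = ⟦ c ⟧ᶜ
      evalT ρ η (fsym g xs) = funᴬ 𝔄 g (ρ ∘ xs)
      evalT ρ η (fvar p xs) = All.lookup η p (ρ ∘ xs)
      evalT ρ η (i ⊕ j)    = evalT ρ η i + evalT ρ η j
      evalT ρ η (i ⊗ j)    = evalT ρ η i * evalT ρ η j

      extend : ∀ {k} → (Fin k → Dom 𝔄) → Dom 𝔄 → Fin (suc k) → Dom 𝔄
      extend ρ a Fin.zero    = a
      extend ρ a (Fin.suc x) = ρ x

      Sat : ∀ {k Γ} → (Fin k → Dom 𝔄) → FEnv Γ → Formula k Γ → Set
      Sat ρ η (eq x y)    = ρ x ≡ ρ y
      Sat ρ η (neq x y)   = ¬ (ρ x ≡ ρ y)
      Sat ρ η (le i j)    = evalT ρ η i ≤ evalT ρ η j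
      Sat ρ η (nle i j)   = ¬ (evalT ρ η i ≤ evalT ρ η j)
      Sat ρ η (rel r xs)  = relᴬ 𝔄 r (ρ ∘ xs)
      Sat ρ η (nrel r xs) = ¬ (relᴬ 𝔄 r (ρ ∘ xs))
      Sat ρ η (and φ ψ)   = Sat ρ η φ × Sat ρ η ψ
      Sat ρ η (or φ ψ)    = Sat ρ η φ ⊎ Sat ρ η ψ
      Sat ρ η (ex φ)      = Σ (Dom 𝔄) λ a → Sat (extend ρ a) η φ
      Sat ρ η (all φ)     = (a : Dom 𝔄) → Sat (extend ρ a) η φ
      Sat ρ η (exf a φ)   = Σ ((Fin a → Dom 𝔄) → ℝ) λ f → Sat ρ (f All.∷ η) φ

  Admissible : (L : Logic) (V : Vocab) → Syntax.Formula V (Const L) 0 [] → Set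
  Admissible L V φ = if loose L then Syntax.IsLoose V (Const L) φ else ⊤

  Sentence : Logic → Vocab → Set
  Sentence L V = Σ[ φ ∈ Syntax.Formula V (Const L) 0 [] ] Admissible L V φ

  _⊨_ : {V : Vocab} {L : Logic} → Structure V → Sentence L V → Set
  _⊨_ {V} {L} 𝔄 (φ , _) = Syntax.Sem.Sat V (Const L) (⟦_⟧ᶜ L) 𝔄 (λ ()) All.[] φ

  _≤L_ : Logic → Logic → Set₁
  L₁ ≤L L₂ = (V : Vocab) (φ : Sentence L₁ V) →
             Σ[ ψ ∈ Sentence L₂ V ] ((𝔄 : Structure V) →
               ((_⊨_ {V} {L₁} 𝔄 φ) → (_⊨_ {V} {L₂} 𝔄 ψ)) ×
               ((_⊨_ {V} {L₂} 𝔄 ψ) → (_⊨_ {V} {L₁} 𝔄 φ)))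

  _≡L_ : Logic → Logic → Set₁
  L₁ ≡L L₂ = (L₁ ≤L L₂) × (L₂ ≤L L₁)

-- Both equivalences come from two sentence translations that commute with every
-- connective and quantifier and only rewrite the numerical atoms.
-- Negated atoms are removed using the constant 1 and function quantification:
-- ¬ i ≤ j holds iff j ≤ i and the difference i − j has a multiplicative inverse,
-- i.e. iff there are nullary d, e with i = j + d and d·e = 1.
-- Conversely, the constants 0 and 1 are removed by guessing nullary functions z, o
-- with z + z = z, o·o = o and o ≠ z; this needs a negated atom, which the full
-- logic has, and over a field it pins z and o down to 0 and 1.

module Submission where

open import Defs
open import Data.Bool using (Bool; true; false)
open import Data.Fin using (Fin)
open import Data.List using (_∷_)
open import Data.List.Membership.Propositional using (_∈_)
open import Data.List.Relation.Unary.Any using (here; there)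
open import Data.List.Relation.Unary.All as All using ()
open import Data.Product using (∃₂; _×_; _,_; proj₁; proj₂; map₂)
open import Data.Product.Function.NonDependent.Propositional using (_×-⇔_)
open import Data.Sum using (_⊎_; inj₁; inj₂)
open import Data.Sum.Function.Propositional using (_⊎-⇔_)
open import Data.Unit using (tt)
open import Data.Vec.Functional using ([])
open import Function using (_∘_; id)
open import Function.Bundles using (_⇔_; mk⇔; Equivalence)
open import Function.Construct.Composition using (_⇔-∘_)
open import Function.Construct.Identity using (⇔-id)
open import Function.Construct.Symmetry using (⇔-sym)
open import Relation.Nullary using (¬_; contradiction)
open import Relation.Binary.PropositionalEquality

open Equivalence using (to; from)

module _ (R : RealField) where
  open RealField R

  +-identityʳ : ∀ x → x + 0r ≡ x
  +-identityʳ x = trans (+-comm x 0r) (+-identityˡ x)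

  *-identityʳ : ∀ x → x * 1r ≡ x
  *-identityʳ x = trans (*-comm x 1r) (*-identityˡ x)

  x+[-x+y]≡y : ∀ x y → x + (- x + y) ≡ y
  x+[-x+y]≡y x y = begin
    x + (- x + y)  ≡⟨ sym (+-assoc x (- x) y) ⟩
    (x + - x) + y  ≡⟨ cong (_+ y) (trans (+-comm x (- x)) (-‿inverseˡ x)) ⟩
    0r + y         ≡⟨ +-identityˡ y ⟩
    y              ∎
    where open ≡-Reasoning

  x+d≡x⇒d≡0 : ∀ x d → x + d ≡ x → d ≡ 0r
  x+d≡x⇒d≡0 x d x+d≡x = begin
    d              ≡⟨ sym (+-identityˡ d) ⟩
    0r + d         ≡⟨ cong (_+ d) (sym (-‿inverseˡ x)) ⟩
    (- x + x) + d  ≡⟨ +-assoc (- x) x d ⟩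
    - x + (x + d)  ≡⟨ cong (- x +_) x+d≡x ⟩
    - x + x        ≡⟨ -‿inverseˡ x ⟩
    0r             ∎
    where open ≡-Reasoning

  zeroˡ : ∀ x → 0r * x ≡ 0r
  zeroˡ x = x+d≡x⇒d≡0 (0r * x) (0r * x) (begin
    0r * x + 0r * x  ≡⟨ cong₂ _+_ (*-comm 0r x) (*-comm 0r x) ⟩
    x * 0r + x * 0r  ≡⟨ sym (distribˡ x 0r 0r) ⟩
    x * (0r + 0r)    ≡⟨ cong (x *_) (+-identityˡ 0r) ⟩
    x * 0r           ≡⟨ *-comm x 0r ⟩
    0r * x           ∎)
    where open ≡-Reasoning

  x*x≡x⇒x≡1 : ∀ x → x * x ≡ x → ¬ x ≡ 0r → x ≡ 1r
  x*x≡x⇒x≡1 x x*x≡x x≢0 with *-inverse x x≢0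
  ... | y , x*y≡1 = begin
    x            ≡⟨ sym (*-identityʳ x) ⟩
    x * 1r       ≡⟨ cong (x *_) (sym x*y≡1) ⟩
    x * (x * y)  ≡⟨ sym (*-assoc x x y) ⟩
    (x * x) * y  ≡⟨ cong (_* y) x*x≡x ⟩
    x * y        ≡⟨ x*y≡1 ⟩
    1r           ∎
    where open ≡-Reasoning

  ≤∧≥⇔≡ : ∀ {x y} → (x ≤ y × y ≤ x) ⇔ (x ≡ y)
  ≤∧≥⇔≡ {x} = mk⇔ (λ (x≤y , y≤x) → ≤-antisym x≤y y≤x)
                  (λ { refl → ≤-refl x , ≤-refl x })

  ≢⇔≰⊎≱ : ∀ x y → (¬ x ≡ y) ⇔ (¬ x ≤ y ⊎ ¬ y ≤ x)
  ≢⇔≰⊎≱ x y = mk⇔ to′ from′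
    where
    to′ : ¬ x ≡ y → ¬ x ≤ y ⊎ ¬ y ≤ x
    to′ x≢y with ≤-total x y
    ... | inj₁ x≤y = inj₂ (λ y≤x → x≢y (≤-antisym x≤y y≤x))
    ... | inj₂ y≤x = inj₁ (λ x≤y → x≢y (≤-antisym x≤y y≤x))
    from′ : ¬ x ≤ y ⊎ ¬ y ≤ x → ¬ x ≡ y
    from′ (inj₁ x≰y) refl = x≰y (≤-refl x)
    from′ (inj₂ y≰x) refl = y≰x (≤-refl x)

  ≰⇔≥∧invertible-gap : ∀ x y →
    (¬ x ≤ y) ⇔ (y ≤ x × ∃₂ λ d e → x ≡ y + d × d * e ≡ 1r)
  ≰⇔≥∧invertible-gap x y = mk⇔ to′ from′
    where
    to′ : ¬ x ≤ y → y ≤ x × ∃₂ λ d e → x ≡ y + d × d * e ≡ 1r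
    to′ x≰y with ≤-total x y
    ... | inj₁ x≤y = contradiction x≤y x≰y
    ... | inj₂ y≤x = y≤x , d , e , x≡y+d , d*e≡1
      where
      d = - y + x
      x≡y+d : x ≡ y + d
      x≡y+d = sym (x+[-x+y]≡y y x)
      d≢0 : ¬ d ≡ 0r
      d≢0 d≡0 = x≰y (subst (x ≤_) (trans x≡y+d (trans (cong (y +_) d≡0) (+-identityʳ y)))
                                   (≤-refl x))
      e = proj₁ (*-inverse d d≢0)
      d*e≡1 = proj₂ (*-inverse d d≢0)
    from′ : y ≤ x × (∃₂ λ d e → x ≡ y + d × d * e ≡ 1r) → ¬ x ≤ y
    from′ (y≤x , d , e , x≡y+d , d*e≡1) x≤y = 0≢1 (begin
      0r      ≡⟨ sym (zeroˡ e) ⟩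
      0r * e  ≡⟨ cong (_* e) (sym d≡0) ⟩
      d * e   ≡⟨ d*e≡1 ⟩
      1r      ∎)
      where
      open ≡-Reasoning
      d≡0 : d ≡ 0r
      d≡0 = x+d≡x⇒d≡0 y d (trans (sym x≡y+d) (≤-antisym x≤y y≤x))

  module Translation (V : Vocab) {C₁ C₂ : Set} (⟦_⟧₁ : C₁ → ℝ) (⟦_⟧₂ : C₂ → ℝ) where
    module S₁ = Syntax R V C₁
    module S₂ = Syntax R V C₂

    module _ (𝔄 : Structure R V) where
      open S₁.Sem ⟦_⟧₁ 𝔄 public using () renaming (evalT to eval₁; Sat to Sat₁)
      open S₂.Sem ⟦_⟧₂ 𝔄 public using (FEnv) renaming (evalT to eval₂; Sat to Sat₂)

    mapTerm : ∀ {k Γ Δ} → (∀ {a} → a ∈ Γ → a ∈ Δ) → (C₁ → S₂.Term k Δ) →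
              S₁.Term k Γ → S₂.Term k Δ
    mapTerm σ κ (S₁.const c)   = κ c
    mapTerm σ κ (S₁.fsym g xs) = S₂.fsym g xs
    mapTerm σ κ (S₁.fvar p xs) = S₂.fvar (σ p) xs
    mapTerm σ κ (i S₁.⊕ j)     = mapTerm σ κ i S₂.⊕ mapTerm σ κ j
    mapTerm σ κ (i S₁.⊗ j)     = mapTerm σ κ i S₂.⊗ mapTerm σ κ j

    eval-mapTerm : ∀ (𝔄 : Structure R V) {k Γ Δ} (σ : ∀ {a} → a ∈ Γ → a ∈ Δ)
      (κ : C₁ → S₂.Term k Δ) ρ (η : FEnv 𝔄 Γ) (η′ : FEnv 𝔄 Δ) →
      (∀ {a} (p : a ∈ Γ) → All.lookup η′ (σ p) ≡ All.lookup η p) →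
      (∀ c → eval₂ 𝔄 ρ η′ (κ c) ≡ ⟦ c ⟧₁) →
      ∀ t → eval₂ 𝔄 ρ η′ (mapTerm σ κ t) ≡ eval₁ 𝔄 ρ η t
    eval-mapTerm 𝔄 σ κ ρ η η′ σ-ok κ-ok = go
      where
      go : ∀ t → eval₂ 𝔄 ρ η′ (mapTerm σ κ t) ≡ eval₁ 𝔄 ρ η t
      go (S₁.const c)   = κ-ok c
      go (S₁.fsym g xs) = refl
      go (S₁.fvar p xs) = cong (λ f → f (ρ ∘ xs)) (σ-ok p)
      go (i S₁.⊕ j)     = cong₂ _+_ (go i) (go j)
      go (i S₁.⊗ j)     = cong₂ _*_ (go i) (go j)

    infix 4 _≐_
    _≐_ : ∀ {k Γ} → S₂.Term k Γ → S₂.Term k Γ → S₂.Formula k Γ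
    i ≐ j = S₂.and (S₂.le i j) (S₂.le j i)

    ≐-loose : ∀ {k Γ} (i j : S₂.Term k Γ) → S₂.IsLoose (i ≐ j)
    ≐-loose i j = S₂.and (S₂.le i j) (S₂.le j i)

    module Homomorphic (leᵗ nleᵗ : ∀ {k Γ} → S₁.Term k Γ → S₁.Term k Γ → S₂.Formula k Γ) where

      translate : ∀ {k Γ} → S₁.Formula k Γ → S₂.Formula k Γ
      translate (S₁.eq x y)    = S₂.eq x y
      translate (S₁.neq x y)   = S₂.neq x y
      translate (S₁.le i j)    = leᵗ i j
      translate (S₁.nle i j)   = nleᵗ i j
      translate (S₁.rel r xs)  = S₂.rel r xs
      translate (S₁.nrel r xs) = S₂.nrel r xs
      translate (S₁.and φ ψ)   = S₂.and (translate φ) (translate ψ)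
      translate (S₁.or φ ψ)    = S₂.or (translate φ) (translate ψ)
      translate (S₁.ex φ)      = S₂.ex (translate φ)
      translate (S₁.all φ)     = S₂.all (translate φ)
      translate (S₁.exf a φ)   = S₂.exf a (translate φ)

      translate-loose : (∀ {k Γ} (i j : S₁.Term k Γ) → S₂.IsLoose (leᵗ i j)) →
                        (∀ {k Γ} (i j : S₁.Term k Γ) → S₂.IsLoose (nleᵗ i j)) →
                        ∀ {k Γ} (φ : S₁.Formula k Γ) → S₂.IsLoose (translate φ)
      translate-loose le-loose nle-loose = go
        where
        go : ∀ {k Γ} (φ : S₁.Formula k Γ) → S₂.IsLoose (translate φ)
        go (S₁.eq x y)    = S₂.eq x y
        go (S₁.neq x y)   = S₂.neq x y
        go (S₁.le i j)    = le-loose i j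
        go (S₁.nle i j)   = nle-loose i j
        go (S₁.rel r xs)  = S₂.rel r xs
        go (S₁.nrel r xs) = S₂.nrel r xs
        go (S₁.and φ ψ)   = S₂.and (go φ) (go ψ)
        go (S₁.or φ ψ)    = S₂.or (go φ) (go ψ)
        go (S₁.ex φ)      = S₂.ex (go φ)
        go (S₁.all φ)     = S₂.all (go φ)
        go (S₁.exf a φ)   = S₂.exf a (go φ)

      module _ (𝔄 : Structure R V)
        (le-sat  : ∀ {k Γ} ρ η (i j : S₁.Term k Γ) →
                   Sat₂ 𝔄 ρ η (leᵗ i j) ⇔ (eval₁ 𝔄 ρ η i ≤ eval₁ 𝔄 ρ η j))
        (nle-sat : ∀ {k Γ} ρ η (i j : S₁.Term k Γ) →
                   Sat₂ 𝔄 ρ η (nleᵗ i j) ⇔ (¬ eval₁ 𝔄 ρ η i ≤ eval₁ 𝔄 ρ η j))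
        where

        translate-sat : ∀ {k Γ} ρ η (φ : S₁.Formula k Γ) →
                        Sat₂ 𝔄 ρ η (translate φ) ⇔ Sat₁ 𝔄 ρ η φ
        translate-sat ρ η (S₁.eq x y)    = ⇔-id _
        translate-sat ρ η (S₁.neq x y)   = ⇔-id _
        translate-sat ρ η (S₁.le i j)    = le-sat ρ η i j
        translate-sat ρ η (S₁.nle i j)   = nle-sat ρ η i j
        translate-sat ρ η (S₁.rel r xs)  = ⇔-id _
        translate-sat ρ η (S₁.nrel r xs) = ⇔-id _
        translate-sat ρ η (S₁.and φ ψ)   = translate-sat ρ η φ ×-⇔ translate-sat ρ η ψ
        translate-sat ρ η (S₁.or φ ψ)    = translate-sat ρ η φ ⊎-⇔ translate-sat ρ η ψ
        translate-sat ρ η (S₁.ex φ)      =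
          mk⇔ (map₂ (to (translate-sat _ η φ))) (map₂ (from (translate-sat _ η φ)))
        translate-sat ρ η (S₁.all φ)     =
          mk⇔ (λ h a → to (translate-sat _ η φ) (h a)) (λ h a → from (translate-sat _ η φ) (h a))
        translate-sat ρ η (S₁.exf a φ)   =
          mk⇔ (map₂ (to (translate-sat ρ _ φ))) (map₂ (from (translate-sat ρ _ φ)))

  module NegationElimination (V : Vocab) {C₁ C₂ : Set} (⟦_⟧₁ : C₁ → ℝ) (⟦_⟧₂ : C₂ → ℝ)
    (embed : C₁ → C₂) (embed-sound : ∀ c → ⟦ embed c ⟧₂ ≡ ⟦ c ⟧₁)
    (one : C₂) (one-sound : ⟦ one ⟧₂ ≡ 1r) where

    open Translation V ⟦_⟧₁ ⟦_⟧₂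

    embedTerm : ∀ {k Γ} → S₁.Term k Γ → S₂.Term k Γ
    embedTerm = mapTerm id (S₂.const ∘ embed)

    embedTerm² : ∀ {k Γ a b} → S₁.Term k Γ → S₂.Term k (a ∷ b ∷ Γ)
    embedTerm² = mapTerm (there ∘ there) (S₂.const ∘ embed)

    notLe : ∀ {k Γ} → S₁.Term k Γ → S₁.Term k Γ → S₂.Formula k Γ
    notLe i j = S₂.and (S₂.le (embedTerm j) (embedTerm i)) (S₂.exf 0 (S₂.exf 0
      (S₂.and (embedTerm² i ≐ embedTerm² j S₂.⊕ d) (d S₂.⊗ e ≐ S₂.const one))))
      where
      d e : ∀ {k Γ} → S₂.Term k (0 ∷ 0 ∷ Γ)
      d = S₂.fvar (there (here refl)) []
      e = S₂.fvar (here refl) []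

    open Translation.Homomorphic V ⟦_⟧₁ ⟦_⟧₂
           (λ i j → S₂.le (embedTerm i) (embedTerm j)) notLe public

    translate-isLoose : ∀ {k Γ} (φ : S₁.Formula k Γ) → S₂.IsLoose (translate φ)
    translate-isLoose = translate-loose (λ i j → S₂.le _ _)
      (λ i j → S₂.and (S₂.le _ _) (S₂.exf 0 (S₂.exf 0 (S₂.and (≐-loose _ _) (≐-loose _ _)))))

    module _ (𝔄 : Structure R V) where

      eval-embedTerm : ∀ {k Γ} ρ (η : FEnv 𝔄 Γ) (t : S₁.Term k Γ) →
                       eval₂ 𝔄 ρ η (embedTerm t) ≡ eval₁ 𝔄 ρ η t
      eval-embedTerm ρ η = eval-mapTerm 𝔄 id _ ρ η η (λ _ → refl) embed-sound

      eval-embedTerm² : ∀ {k Γ a b} ρ (η : FEnv 𝔄 Γ) f g (t : S₁.Term k Γ) →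
                        eval₂ 𝔄 ρ (f All.∷ g All.∷ η) (embedTerm² {a = a} {b} t) ≡ eval₁ 𝔄 ρ η t
      eval-embedTerm² ρ η f g = eval-mapTerm 𝔄 (there ∘ there) _ ρ η _ (λ _ → refl) embed-sound

      notLe-sat : ∀ {k Γ} ρ η (i j : S₁.Term k Γ) →
                  Sat₂ 𝔄 ρ η (notLe i j) ⇔ (¬ eval₁ 𝔄 ρ η i ≤ eval₁ 𝔄 ρ η j)
      notLe-sat ρ η i j = ⇔-sym (≰⇔≥∧invertible-gap vi vj) ⇔-∘ mk⇔ to′ from′
        where
        vi = eval₁ 𝔄 ρ η i
        vj = eval₁ 𝔄 ρ η j
        Gap = vj ≤ vi × ∃₂ λ d e → vi ≡ vj + d × d * e ≡ 1r
        to′ : Sat₂ 𝔄 ρ η (notLe i j) → Gap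
        to′ (j≤i , fd , fe , i≐j+d , d*e≐1) =
            subst₂ _≤_ (eval-embedTerm ρ η j) (eval-embedTerm ρ η i) j≤i
          , fd _ , fe _
          , subst₂ (λ x y → x ≡ y + fd _) (eval-embedTerm² ρ η fe fd i) (eval-embedTerm² ρ η fe fd j)
                   (to ≤∧≥⇔≡ i≐j+d)
          , trans (to ≤∧≥⇔≡ d*e≐1) one-sound
        from′ : Gap → Sat₂ 𝔄 ρ η (notLe i j)
        from′ (j≤i , d , e , i≡j+d , d*e≡1) =
            subst₂ _≤_ (sym (eval-embedTerm ρ η j)) (sym (eval-embedTerm ρ η i)) j≤i
          , (λ _ → d) , (λ _ → e)
          , from ≤∧≥⇔≡
              (subst₂ (λ x y → x ≡ y + d) (sym (eval-embedTerm² ρ η _ _ i))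
                      (sym (eval-embedTerm² ρ η _ _ j)) i≡j+d)
          , from ≤∧≥⇔≡ (trans d*e≡1 (sym one-sound))

      translate-correct : ∀ {k Γ} ρ η (φ : S₁.Formula k Γ) →
                       Sat₂ 𝔄 ρ η (translate φ) ⇔ Sat₁ 𝔄 ρ η φ
      translate-correct = translate-sat 𝔄
        (λ ρ η i j → mk⇔ (subst₂ _≤_ (eval-embedTerm ρ η i) (eval-embedTerm ρ η j))
                         (subst₂ _≤_ (sym (eval-embedTerm ρ η i)) (sym (eval-embedTerm ρ η j))))
        notLe-sat

  module ConstantElimination (V : Vocab) {C : Set} (⟦_⟧ : C → ℝ) where

    open Translation V (zeroOne R) ⟦_⟧

    z o : ∀ {k Γ} → S₂.Term k (0 ∷ 0 ∷ Γ)
    z = S₂.fvar (there (here refl)) []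
    o = S₂.fvar (here refl) []

    zeroOneTerm : ∀ {k Γ} → Bool → S₂.Term k (0 ∷ 0 ∷ Γ)
    zeroOneTerm false = z
    zeroOneTerm true  = o

    liftTerm : ∀ {k Γ} → S₁.Term k Γ → S₂.Term k (0 ∷ 0 ∷ Γ)
    liftTerm = mapTerm (there ∘ there) zeroOneTerm

    IsZeroOne : ∀ {k Γ} → S₂.Formula k (0 ∷ 0 ∷ Γ)
    IsZeroOne = S₂.and (z S₂.⊕ z ≐ z) (S₂.and (o S₂.⊗ o ≐ o) (S₂.or (S₂.nle o z) (S₂.nle z o)))

    withZeroOne : ∀ {k Γ} → S₂.Formula k (0 ∷ 0 ∷ Γ) → S₂.Formula k Γ
    withZeroOne ψ = S₂.exf 0 (S₂.exf 0 (S₂.and IsZeroOne ψ))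

    open Translation.Homomorphic V (zeroOne R) ⟦_⟧
           (λ i j → withZeroOne (S₂.le (liftTerm i) (liftTerm j)))
           (λ i j → withZeroOne (S₂.nle (liftTerm i) (liftTerm j))) public

    module _ (𝔄 : Structure R V) where

      Nullary : Set
      Nullary = (Fin 0 → Dom 𝔄) → ℝ

      IsZeroOne-sat : ∀ {k Γ} ρ (η : FEnv 𝔄 Γ) (fo fz : Nullary) →
        Sat₂ 𝔄 ρ (fo All.∷ fz All.∷ η) (IsZeroOne {k}) ⇔ (fz (ρ ∘ []) ≡ 0r × fo (ρ ∘ []) ≡ 1r)
      IsZeroOne-sat ρ η fo fz = mk⇔ to′ from′
        where
        z₀ = fz (ρ ∘ [])
        o₀ = fo (ρ ∘ [])
        to′ : Sat₂ 𝔄 ρ (fo All.∷ fz All.∷ η) IsZeroOne → z₀ ≡ 0r × o₀ ≡ 1r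
        to′ (z+z≐z , o*o≐o , o≢z) = z₀≡0 , x*x≡x⇒x≡1 o₀ (to ≤∧≥⇔≡ o*o≐o) o₀≢0
          where
          z₀≡0 = x+d≡x⇒d≡0 z₀ z₀ (to ≤∧≥⇔≡ z+z≐z)
          o₀≢0 : ¬ o₀ ≡ 0r
          o₀≢0 o₀≡0 = from (≢⇔≰⊎≱ o₀ z₀) o≢z (trans o₀≡0 (sym z₀≡0))
        from′ : z₀ ≡ 0r × o₀ ≡ 1r → Sat₂ 𝔄 ρ (fo All.∷ fz All.∷ η) IsZeroOne
        from′ (z₀≡0 , o₀≡1) =
            from ≤∧≥⇔≡ (trans (cong₂ _+_ z₀≡0 z₀≡0) (trans (+-identityˡ 0r) (sym z₀≡0)))
          , from ≤∧≥⇔≡ (trans (cong₂ _*_ o₀≡1 o₀≡1) (trans (*-identityˡ 1r) (sym o₀≡1)))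
          , to (≢⇔≰⊎≱ o₀ z₀) (λ o₀≡z₀ → 0≢1 (trans (sym z₀≡0) (trans (sym o₀≡z₀) o₀≡1)))

      eval-liftTerm : ∀ {k Γ} ρ (η : FEnv 𝔄 Γ) (fo fz : Nullary) →
        fz (ρ ∘ []) ≡ 0r → fo (ρ ∘ []) ≡ 1r →
        (t : S₁.Term k Γ) → eval₂ 𝔄 ρ (fo All.∷ fz All.∷ η) (liftTerm t) ≡ eval₁ 𝔄 ρ η t
      eval-liftTerm ρ η fo fz z≡0 o≡1 =
        eval-mapTerm 𝔄 (there ∘ there) zeroOneTerm ρ η _ (λ _ → refl) λ { false → z≡0 ; true → o≡1 }

      withZeroOne-sat : (A : ∀ {k Γ} → S₂.Term k Γ → S₂.Term k Γ → S₂.Formula k Γ)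
        (P : ℝ → ℝ → Set) →
        (∀ {k Γ} ρ η (i j : S₂.Term k Γ) → Sat₂ 𝔄 ρ η (A i j) ⇔ P (eval₂ 𝔄 ρ η i) (eval₂ 𝔄 ρ η j)) →
        ∀ {k Γ} ρ η (i j : S₁.Term k Γ) →
        Sat₂ 𝔄 ρ η (withZeroOne (A (liftTerm i) (liftTerm j))) ⇔ P (eval₁ 𝔄 ρ η i) (eval₁ 𝔄 ρ η j)
      withZeroOne-sat A P A-sat ρ η i j = mk⇔ to′ from′
        where
        to′ : Sat₂ 𝔄 ρ η (withZeroOne (A (liftTerm i) (liftTerm j))) →
              P (eval₁ 𝔄 ρ η i) (eval₁ 𝔄 ρ η j)
        to′ (fz , fo , zero-one , a) =
          subst₂ P (eval-liftTerm ρ η fo fz z≡0 o≡1 i) (eval-liftTerm ρ η fo fz z≡0 o≡1 j)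
                   (to (A-sat ρ _ _ _) a)
          where
          z≡0 = proj₁ (to (IsZeroOne-sat ρ η fo fz) zero-one)
          o≡1 = proj₂ (to (IsZeroOne-sat ρ η fo fz) zero-one)
        from′ : P (eval₁ 𝔄 ρ η i) (eval₁ 𝔄 ρ η j) →
                Sat₂ 𝔄 ρ η (withZeroOne (A (liftTerm i) (liftTerm j)))
        from′ p = zero , one , from (IsZeroOne-sat ρ η one zero) (refl , refl)
          , from (A-sat ρ _ _ _)
              (subst₂ P (sym (eval-liftTerm ρ η one zero refl refl i))
                        (sym (eval-liftTerm ρ η one zero refl refl j)) p)
          where
          zero one : Nullary
          zero _ = 0r
          one _ = 1r

      translate-correct : ∀ {k Γ} ρ η (φ : S₁.Formula k Γ) →
                          Sat₂ 𝔄 ρ η (translate φ) ⇔ Sat₁ 𝔄 ρ η φ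
      translate-correct = translate-sat 𝔄
        (withZeroOne-sat S₂.le _≤_ (λ _ _ _ _ → ⇔-id _))
        (withZeroOne-sat S₂.nle (λ x y → ¬ x ≤ y) (λ _ _ _ _ → ⇔-id _))

  L-ESO01≤ESO : _≤L_ R (L-ESO01 R) (ESO R)
  L-ESO01≤ESO V (φ , _) =
    (translate φ , tt) , λ 𝔄 → from (translate-correct 𝔄 _ _ φ) , to (translate-correct 𝔄 _ _ φ)
    where open ConstantElimination V (⟦_⟧ᶜ (ESO R))

  ESO≤L-ESO01 : _≤L_ R (ESO R) (L-ESO01 R)
  ESO≤L-ESO01 V (φ , _) =
    (translate φ , translate-isLoose φ) ,
    λ 𝔄 → from (translate-correct 𝔄 _ _ φ) , to (translate-correct 𝔄 _ _ φ)
    where open NegationElimination V (⟦_⟧ᶜ (ESO R)) (zeroOne R) (λ ()) (λ ()) true refl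

  L-ESO-ℝ≤ESO-ℝ : _≤L_ R (L-ESO-ℝ R) (ESO-ℝ R)
  L-ESO-ℝ≤ESO-ℝ V (φ , _) = (φ , tt) , λ 𝔄 → id , id

  ESO-ℝ≤L-ESO-ℝ : _≤L_ R (ESO-ℝ R) (L-ESO-ℝ R)
  ESO-ℝ≤L-ESO-ℝ V (φ , _) =
    (translate φ , translate-isLoose φ) ,
    λ 𝔄 → from (translate-correct 𝔄 _ _ φ) , to (translate-correct 𝔄 _ _ φ)
    where open NegationElimination V id id id (λ _ → refl) 1r refl

proposition5p2 : (R : RealField) →
    (_≡L_ R (L-ESO01 R) (ESO R)) × (_≡L_ R (L-ESO-ℝ R) (ESO-ℝ R))
proposition5p2 R =
  (L-ESO01≤ESO R , ESO≤L-ESO01 R) , (L-ESO-ℝ≤ESO-ℝ R , ESO-ℝ≤L-ESO-ℝ R)
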